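{- If $\mathbf{H}=(H,\leq,\wedge,\vee,0,1,\to)$ is a Heyting algebra, then its canonical frame $(X,\upharpoonleft,Y,T)$ is a Heyting frame.
   Context: Canonical frame: $X$ the set of filters, $Y$ the set of ideals of $\mathbf{H}$; $x\upharpoonleft y$ iff $x\cap y\neq\emptyset$; for $x\in X,v\in Y$, $x\leadsto v$ is the ideal generated by $\{a\to b:a\in x,b\in v\}$; $T\subseteq Y\times X\times Y$ with $yTxv$ iff $x\leadsto v\subseteq y$. General notions: for $U\subseteq X$, $V\subseteq Y$, $U^{\perp}=\{y:\forall x\in U\ x\upharpoonleft y\}$, ${}^{\perp}V=\{x:\forall y\in V\ x\upharpoonleft y\}$; stable sets $A={}^\perp(A^\perp)$, co-stable sets $B=({}^\perp B)^\perp$, both called Galois sets. Orders: $x\leq z$ iff $\{x\}^\perp\subseteq\{z\}^\perp$, $y\leq v$ iff ${}^\perp\{y\}\subseteq{}^\perp\{v\}$; $\Gamma u=\{w:u\leq w\}$. $T'\subseteq X\times X\times Y$: $uT'xv$ iff $\forall y(yTxv\Rightarrow u\upharpoonleft y)$. An implicative frame satisfies: (F0) $x\upharpoonleft y$ iff $uT'xy$ for all $u\in X$; (F1) the orders are partial orders; (F2) each $\{y:yTxv\}$ equals $\Gamma w$ for some $w\in Y$; (F3) $yTxv$, $x_1\leq x$, $v_1\leq v$ imply $yTx_1v_1$; (F4) for all $z,x\in X$, $v\in Y$, the sets $\{x_1:zT'x_1v\}$, $\{v_1:zT'xv_1\}$ are Galois sets. Derived relations: $vR^{\partial11}zx$ iff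 $xT'zv$; $uR^{111}zx$ iff $\forall v(vR^{\partial11}zx\Rightarrow u\upharpoonleft v)$; upper bound relation $uR_\leq xz$ iff $x\leq u$ and $z\leq u$. A Heyting frame is an implicative frame with $\{u:uR^{111}xz\}=\{u:uR_\leq xz\}$ for all $x,z\in X$. -}

module Defs where

open import Level using (Level; _⊔_; suc)
open import Data.Product using (Σ; Σ-syntax; ∃; ∃-syntax; _×_; _,_; proj₁; proj₂)
open import Data.List using (List; foldr; map)
open import Data.List.Relation.Unary.All using (All)
open import Relation.Unary using (Pred; _∈_; _⊆_; _≐_)
open import Relation.Binary.Core using (Rel)
open import Relation.Binary.Structures using (IsPartialOrder)
open import Relation.Binary.Lattice.Bundles using (HeytingAlgebra)

module FrameNotions {a b e : Level} {X Y : Set a}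
  (_≈X_ : Rel X e) (_≈Y_ : Rel Y e)
  (_↿_ : X → Y → Set b) (T : Y → X → Y → Set b) where

  L : Level
  L = a ⊔ b

  _ᵖ : Pred X L → Pred Y L
  (U ᵖ) y = ∀ {x} → x ∈ U → x ↿ y

  ᵖ_ : Pred Y L → Pred X L
  (ᵖ V) x = ∀ {y} → y ∈ V → x ↿ y

  Stable : Pred X L → Set L
  Stable A = A ≐ ᵖ (A ᵖ)

  CoStable : Pred Y L → Set L
  CoStable B = B ≐ (ᵖ B) ᵖ

  _≤X_ : X → X → Set L
  x ≤X z = ∀ y → x ↿ y → z ↿ y

  _≤Y_ : Y → Y → Set L
  y ≤Y v = ∀ x → x ↿ y → x ↿ v

  ΓY : Y → Pred Y L
  ΓY w v = w ≤Y v

  T′ : X → X → Y → Set L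
  T′ u x v = ∀ y → T y x v → u ↿ y

  R∂11 : Y → X → X → Set L
  R∂11 v z x = T′ x z v

  R111 : X → X → X → Set L
  R111 u z x = ∀ v → R∂11 v z x → u ↿ v

  R≤ : X → X → X → Set L
  R≤ u x z = (x ≤X u) × (z ≤X u)

  record IsImplicativeFrame : Set (L ⊔ e) where
    field
      F0  : ∀ x y → (x ↿ y → ∀ u → T′ u x y) × ((∀ u → T′ u x y) → x ↿ y)
      F1X : IsPartialOrder _≈X_ _≤X_
      F1Y : IsPartialOrder _≈Y_ _≤Y_
      F2  : ∀ x v → ∃[ w ] ((λ y → T y x v) ≐ ΓY w)
      F3  : ∀ y x v x₁ v₁ → T y x v → x₁ ≤X x → v₁ ≤Y v → T y x₁ v₁
      F4X : ∀ z (x : X) (v : Y) → Stable (λ x₁ → T′ z x₁ v)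
      F4Y : ∀ z (x : X) (v : Y) → CoStable (λ v₁ → T′ z x v₁)

  record IsHeytingFrame : Set (L ⊔ e) where
    field
      implicative : IsImplicativeFrame
      heyting     : ∀ x z → (λ u → R111 u x z) ≐ (λ u → R≤ u x z)

module Canonical {c ℓ₁ ℓ₂ : Level} (H : HeytingAlgebra c ℓ₁ ℓ₂) where
  open HeytingAlgebra H

  ℓ : Level
  ℓ = c ⊔ ℓ₁ ⊔ ℓ₂

  record IsFilter (F : Pred Carrier ℓ) : Set ℓ where
    field
      nonempty : ∃[ p ] F p
      upward   : ∀ {p q} → F p → p ≤ q → F q
      meet     : ∀ {p q} → F p → F q → F (p ∧ q)

  record IsIdeal (I : Pred Carrier ℓ) : Set ℓ where
    field
      nonempty : ∃[ p ] I p
      downward : ∀ {p q} → I q → p ≤ q → I p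
      join     : ∀ {p q} → I p → I q → I (p ∨ q)

  Filt : Set (suc ℓ)
  Filt = Σ (Pred Carrier ℓ) IsFilter

  Idl : Set (suc ℓ)
  Idl = Σ (Pred Carrier ℓ) IsIdeal

  _≈F_ : Rel Filt ℓ
  x ≈F z = proj₁ x ≐ proj₁ z

  _≈I_ : Rel Idl ℓ
  y ≈I v = proj₁ y ≐ proj₁ v

  _↿_ : Filt → Idl → Set ℓ
  x ↿ y = ∃[ p ] (proj₁ x p × proj₁ y p)

  generatedIdeal : Pred Carrier ℓ → Pred Carrier ℓ
  generatedIdeal S p =
    Σ[ l ∈ List Carrier ] (All S l × (p ≤ foldr _∨_ ⊥ l))

  impSet : Filt → Idl → Pred Carrier ℓ
  impSet x v p = Σ[ q ∈ Carrier ] Σ[ r ∈ Carrier ] (proj₁ x q × proj₁ v r × (p ≈ (q ⇨ r)))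

  _⇝_ : Filt → Idl → Pred Carrier ℓ
  x ⇝ v = generatedIdeal (impSet x v)

  Tc : Idl → Filt → Idl → Set ℓ
  Tc y x v = (x ⇝ v) ⊆ proj₁ y

  open FrameNotions _≈F_ _≈I_ _↿_ Tc public

-- The canonical frame is governed by one characterisation: z T′ x v holds iff the
-- filter z ⊔ᶠ x generated by z ∪ x meets v. Indeed z must meet the ideal x ⇝ v, whose
-- elements all lie below a single q ⇨ r with q ∈ x, r ∈ v, and a ≤ q ⇨ r iff a ∧ q ≤ r.
-- Since ⊔ᶠ is the join of filters (ordered by inclusion, which is the frame order),
-- F0, F4 and the Heyting condition R¹¹¹ = R≤ all follow from this, while F1–F3 reduce
-- to the fact that both frame orders are inclusions, tested on principal filters/ideals.
module Submission where

open import Defs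
open import Level using (Level; Lift; lift)
open import Data.Product using (Σ-syntax; ∃₂; _×_; _,_; proj₁; proj₂)
open import Data.List using (List; []; _∷_; _++_; foldr)
open import Data.List.Relation.Unary.All as All using (All; []; _∷_)
open import Data.List.Relation.Unary.All.Properties using (++⁺)
open import Relation.Binary.Core using (Rel)
open import Relation.Binary.Structures using (IsPartialOrder)
open import Relation.Binary.Lattice.Bundles using (HeytingAlgebra)
open import Relation.Unary using (Pred; _⊆_; _≐_)
open import Relation.Unary.Properties using (≐-refl; ≐-sym; ≐-trans)

module _ {a c ℓ r : Level} {A : Set a} {C : Set c} (f : A → Pred C ℓ) {_≤_ : Rel A r}
         (≤⇒⊆ : ∀ x z → x ≤ z → f x ⊆ f z) (⊆⇒≤ : ∀ x z → f x ⊆ f z → x ≤ z) where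

  ⊆-pullback-isPartialOrder : IsPartialOrder (λ x z → f x ≐ f z) _≤_
  ⊆-pullback-isPartialOrder = record
    { isPreorder = record
      { isEquivalence = record { refl = ≐-refl ; sym = ≐-sym ; trans = ≐-trans }
      ; reflexive     = λ {x} {z} fx≐fz → ⊆⇒≤ x z (proj₁ fx≐fz)
      ; trans         = λ {x} {y} {z} x≤y y≤z → ⊆⇒≤ x z (λ p∈fx → ≤⇒⊆ y z y≤z (≤⇒⊆ x y x≤y p∈fx))
      }
    ; antisym = λ {x} {z} x≤z z≤x → ≤⇒⊆ x z x≤z , ≤⇒⊆ z x z≤x
    }

module CanonicalFrame {c ℓ₁ ℓ₂} (H : HeytingAlgebra c ℓ₁ ℓ₂) where
  open HeytingAlgebra H
  open Canonical H
  open import Relation.Binary.Lattice.Properties.HeytingAlgebra H using (⇨-relax)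
  open import Relation.Binary.Lattice.Properties.MeetSemilattice meetSemilattice
    using (∧-monotonic)

  upward : (x : Filt) → ∀ {p q} → proj₁ x p → p ≤ q → proj₁ x q
  upward x = IsFilter.upward (proj₂ x)

  meet : (x : Filt) → ∀ {p q} → proj₁ x p → proj₁ x q → proj₁ x (p ∧ q)
  meet x = IsFilter.meet (proj₂ x)

  downward : (y : Idl) → ∀ {p q} → proj₁ y q → p ≤ q → proj₁ y p
  downward y = IsIdeal.downward (proj₂ y)

  join : (y : Idl) → ∀ {p q} → proj₁ y p → proj₁ y q → proj₁ y (p ∨ q)
  join y = IsIdeal.join (proj₂ y)

  ⊤∈ᶠ : (x : Filt) → proj₁ x ⊤
  ⊤∈ᶠ x = let p , xp = IsFilter.nonempty (proj₂ x) in upward x xp (maximum p)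

  ⊥∈ⁱ : (y : Idl) → proj₁ y ⊥
  ⊥∈ⁱ y = let p , yp = IsIdeal.nonempty (proj₂ y) in downward y yp (minimum p)

  ↑_ : Carrier → Filt
  ↑ p = (λ q → Lift ℓ (p ≤ q)) , record
    { nonempty = p , lift refl
    ; upward   = λ { (lift p≤q) q≤s → lift (trans p≤q q≤s) }
    ; meet     = λ { (lift p≤q) (lift p≤s) → lift (∧-greatest p≤q p≤s) }
    }

  ↓_ : Carrier → Idl
  ↓ p = (λ q → Lift ℓ (q ≤ p)) , record
    { nonempty = p , lift refl
    ; downward = λ { (lift q≤p) s≤q → lift (trans s≤q q≤p) }
    ; join     = λ { (lift q≤p) (lift s≤p) → lift (∨-least q≤p s≤p) }
    }

  ≤X⇒⊆ : ∀ x z → x ≤X z → proj₁ x ⊆ proj₁ z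
  ≤X⇒⊆ x z x≤z {p} xp =
    let q , zq , lift q≤p = x≤z (↓ p) (p , xp , lift refl) in upward z zq q≤p

  ⊆⇒≤X : ∀ x z → proj₁ x ⊆ proj₁ z → x ≤X z
  ⊆⇒≤X x z x⊆z _ (p , xp , yp) = p , x⊆z xp , yp

  ≤Y⇒⊆ : ∀ y v → y ≤Y v → proj₁ y ⊆ proj₁ v
  ≤Y⇒⊆ y v y≤v {p} yp =
    let q , lift p≤q , vq = y≤v (↑ p) (p , lift refl , yp) in downward v vq p≤q

  ⊆⇒≤Y : ∀ y v → proj₁ y ⊆ proj₁ v → y ≤Y v
  ⊆⇒≤Y y v y⊆v _ (p , xp , yp) = p , xp , y⊆v yp

  ⋁ : List Carrier → Carrier
  ⋁ = foldr _∨_ ⊥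

  ⋁-++ˡ : ∀ l l′ → ⋁ l ≤ ⋁ (l ++ l′)
  ⋁-++ˡ []      l′ = minimum _
  ⋁-++ˡ (p ∷ l) l′ = ∨-least (x≤x∨y _ _) (trans (⋁-++ˡ l l′) (y≤x∨y _ _))

  ⋁-++ʳ : ∀ l l′ → ⋁ l′ ≤ ⋁ (l ++ l′)
  ⋁-++ʳ []      l′ = refl
  ⋁-++ʳ (p ∷ l) l′ = trans (⋁-++ʳ l l′) (y≤x∨y _ _)

  generatedIdeal-isIdeal : ∀ S → IsIdeal (generatedIdeal S)
  generatedIdeal-isIdeal S = record
    { nonempty = ⊥ , [] , [] , refl
    ; downward = λ { (l , Sl , q≤⋁l) p≤q → l , Sl , trans p≤q q≤⋁l }
    ; join     = λ { (l , Sl , p≤⋁l) (l′ , Sl′ , q≤⋁l′) →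
        l ++ l′ , ++⁺ Sl Sl′ ,
        ∨-least (trans p≤⋁l (⋁-++ˡ l l′)) (trans q≤⋁l′ (⋁-++ʳ l l′)) }
    }

  _⇝ⁱ_ : Filt → Idl → Idl
  x ⇝ⁱ v = (x ⇝ v) , generatedIdeal-isIdeal (impSet x v)

  ⇨∈⇝ : ∀ x v {q r} → proj₁ x q → proj₁ v r → (x ⇝ v) (q ⇨ r)
  ⇨∈⇝ x v xq vr = _ ∷ [] , (_ , _ , xq , vr , Eq.refl) ∷ [] , x≤x∨y _ _

  ⋁-impSet-bounded : ∀ x v l → All (impSet x v) l →
                     ∃₂ λ q r → proj₁ x q × proj₁ v r × ⋁ l ≤ (q ⇨ r)
  ⋁-impSet-bounded x v [] [] = ⊤ , ⊥ , ⊤∈ᶠ x , ⊥∈ⁱ v , minimum _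
  ⋁-impSet-bounded x v (p ∷ l) ((q₀ , r₀ , xq₀ , vr₀ , p≈q₀⇨r₀) ∷ all) =
    let q , r , xq , vr , ⋁l≤q⇨r = ⋁-impSet-bounded x v l all
    in q₀ ∧ q , r₀ ∨ r , meet x xq₀ xq , join v vr₀ vr ,
       ∨-least (trans (reflexive p≈q₀⇨r₀) (⇨-relax (x∧y≤x _ _) (x≤x∨y _ _)))
               (trans ⋁l≤q⇨r (⇨-relax (x∧y≤y _ _) (y≤x∨y _ _)))

  ⇝-bounded : ∀ x v {p} → (x ⇝ v) p → ∃₂ λ q r → proj₁ x q × proj₁ v r × p ≤ (q ⇨ r)
  ⇝-bounded x v (l , all , p≤⋁l) =
    let q , r , xq , vr , ⋁l≤q⇨r = ⋁-impSet-bounded x v l all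
    in q , r , xq , vr , trans p≤⋁l ⋁l≤q⇨r

  ⇝-antitone : ∀ x x₁ v v₁ → proj₁ x₁ ⊆ proj₁ x → proj₁ v₁ ⊆ proj₁ v →
               (x₁ ⇝ v₁) ⊆ (x ⇝ v)
  ⇝-antitone x x₁ v v₁ x₁⊆x v₁⊆v (l , all , p≤⋁l) =
    l , All.map (λ { (q , r , xq , vr , e) → q , r , x₁⊆x xq , v₁⊆v vr , e }) all , p≤⋁l

  _⊔ᶠ_ : Filt → Filt → Filt
  z ⊔ᶠ x = (λ p → Σ[ a ∈ Carrier ] Σ[ q ∈ Carrier ] (proj₁ z a × proj₁ x q × a ∧ q ≤ p))
         , record
    { nonempty = ⊤ ∧ ⊤ , ⊤ , ⊤ , ⊤∈ᶠ z , ⊤∈ᶠ x , refl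
    ; upward   = λ { (a , q , za , xq , a∧q≤p) p≤s → a , q , za , xq , trans a∧q≤p p≤s }
    ; meet     = λ { (a , q , za , xq , a∧q≤p) (a′ , q′ , za′ , xq′ , a′∧q′≤p′) →
        a ∧ a′ , q ∧ q′ , meet z za za′ , meet x xq xq′ ,
        ∧-greatest (trans (∧-monotonic (x∧y≤x _ _) (x∧y≤x _ _)) a∧q≤p)
                   (trans (∧-monotonic (x∧y≤y _ _) (x∧y≤y _ _)) a′∧q′≤p′) }
    }

  ⊔ᶠ-upperˡ : ∀ z x → proj₁ z ⊆ proj₁ (z ⊔ᶠ x)
  ⊔ᶠ-upperˡ z x zp = _ , ⊤ , zp , ⊤∈ᶠ x , x∧y≤x _ _

  ⊔ᶠ-upperʳ : ∀ z x → proj₁ x ⊆ proj₁ (z ⊔ᶠ x)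
  ⊔ᶠ-upperʳ z x xp = ⊤ , _ , ⊤∈ᶠ z , xp , x∧y≤y _ _

  ⊔ᶠ-least : ∀ z x u → proj₁ z ⊆ proj₁ u → proj₁ x ⊆ proj₁ u → proj₁ (z ⊔ᶠ x) ⊆ proj₁ u
  ⊔ᶠ-least z x u z⊆u x⊆u (a , q , za , xq , a∧q≤p) =
    upward u (meet u (z⊆u za) (x⊆u xq)) a∧q≤p

  T′⇒⊔ᶠ↿ : ∀ z x v → T′ z x v → (z ⊔ᶠ x) ↿ v
  T′⇒⊔ᶠ↿ z x v zT′xv =
    let a , za , a∈x⇝v          = zT′xv (x ⇝ⁱ v) (λ p∈x⇝v → p∈x⇝v)
        q , r , xq , vr , a≤q⇨r = ⇝-bounded x v a∈x⇝v
    in r , (a , q , za , xq , transpose-∧ a≤q⇨r) , vr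

  ⊔ᶠ↿⇒T′ : ∀ z x v → (z ⊔ᶠ x) ↿ v → T′ z x v
  ⊔ᶠ↿⇒T′ z x v (p , (a , q , za , xq , a∧q≤p) , vp) y x⇝v⊆y =
    a , za , downward y (x⇝v⊆y (⇨∈⇝ x v xq vp)) (transpose-⇨ a∧q≤p)

  ⊆⇒T′ : ∀ z x v u → proj₁ u ⊆ proj₁ (z ⊔ᶠ x) → u ↿ v → T′ z x v
  ⊆⇒T′ z x v u u⊆z⊔x (p , up , vp) = ⊔ᶠ↿⇒T′ z x v (p , u⊆z⊔x up , vp)

  T′⇒↿ : ∀ z x v u → proj₁ z ⊆ proj₁ u → proj₁ x ⊆ proj₁ u → T′ z x v → u ↿ v
  T′⇒↿ z x v u z⊆u x⊆u zT′xv =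
    let p , z⊔x∋p , vp = T′⇒⊔ᶠ↿ z x v zT′xv in p , ⊔ᶠ-least z x u z⊆u x⊆u z⊔x∋p , vp

  T′-comm : ∀ z x v → T′ z x v → T′ x z v
  T′-comm z x v zT′xv =
    ⊔ᶠ↿⇒T′ x z v (T′⇒↿ z x v (x ⊔ᶠ z) (⊔ᶠ-upperʳ x z) (⊔ᶠ-upperˡ x z) zT′xv)

  ↿⇔T′ : ∀ x y → (x ↿ y → ∀ u → T′ u x y) × ((∀ u → T′ u x y) → x ↿ y)
  ↿⇔T′ x y =
    (λ x↿y u → ⊆⇒T′ u x y x (⊔ᶠ-upperʳ u x) x↿y) ,
    (λ uT′xy → T′⇒↿ x x y x (λ xp → xp) (λ xp → xp) (uT′xy x))

  Tc-principal : ∀ x v → (λ y → Tc y x v) ≐ ΓY (x ⇝ⁱ v)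
  Tc-principal x v = (λ {y} → ⊆⇒≤Y (x ⇝ⁱ v) y) , (λ {y} → ≤Y⇒⊆ (x ⇝ⁱ v) y)

  Tc-antitone : ∀ y x v x₁ v₁ → Tc y x v → x₁ ≤X x → v₁ ≤Y v → Tc y x₁ v₁
  Tc-antitone y x v x₁ v₁ x⇝v⊆y x₁≤x v₁≤v p∈x₁⇝v₁ =
    x⇝v⊆y (⇝-antitone x x₁ v v₁ (≤X⇒⊆ x₁ x x₁≤x) (≤Y⇒⊆ v₁ v v₁≤v) p∈x₁⇝v₁)

  -- By T′-comm, z T′ x₁ v says that x₁ meets every y with y T z v, and each such y
  -- lies in the polar of the set.
  T′-stable : ∀ z (x : Filt) v → Stable (λ x₁ → T′ z x₁ v)
  T′-stable z _ v =
    (λ {x₁} zT′x₁v y∈⊥ → y∈⊥ {x₁} zT′x₁v) ,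
    (λ {x₁} x₁∈⊥⊥ → T′-comm x₁ z v (λ y zTy → x₁∈⊥⊥ {y} (λ {x′} → T-in-polar y zTy x′)))
    where
    T-in-polar : ∀ y → Tc y z v → ∀ x′ → T′ z x′ v → x′ ↿ y
    T-in-polar y zTy x′ zT′x′v = T′-comm z x′ v zT′x′v y zTy

  T′-coStable : ∀ z x (v : Idl) → CoStable (λ v₁ → T′ z x v₁)
  T′-coStable z x _ =
    (λ {v₁} zT′xv₁ x′∈⊥ → x′∈⊥ {v₁} zT′xv₁) ,
    (λ {v₁} v₁∈⊥⊥ → ⊔ᶠ↿⇒T′ z x v₁ (v₁∈⊥⊥ {z ⊔ᶠ x} (λ {v′} → T′⇒⊔ᶠ↿ z x v′)))

  R111≐R≤ : ∀ x z → (λ u → R111 u x z) ≐ (λ u → R≤ u x z)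
  R111≐R≤ x z =
    (λ u∈R111 → (λ y x↿y → u∈R111 y (⊆⇒T′ z x y x (⊔ᶠ-upperʳ z x) x↿y)) ,
                (λ y z↿y → u∈R111 y (⊆⇒T′ z x y z (⊔ᶠ-upperˡ z x) z↿y))) ,
    (λ {u} (x≤u , z≤u) v → T′⇒↿ z x v u (≤X⇒⊆ z u z≤u) (≤X⇒⊆ x u x≤u))

  isHeytingFrame : IsHeytingFrame
  isHeytingFrame = record
    { implicative = record
      { F0  = ↿⇔T′
      ; F1X = ⊆-pullback-isPartialOrder (λ (x : Filt) → proj₁ x) ≤X⇒⊆ ⊆⇒≤X
      ; F1Y = ⊆-pullback-isPartialOrder (λ (y : Idl) → proj₁ y) ≤Y⇒⊆ ⊆⇒≤Y
      ; F2  = λ x v → x ⇝ⁱ v , Tc-principal x v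
      ; F3  = Tc-antitone
      ; F4X = T′-stable
      ; F4Y = T′-coStable
      }
    ; heyting = R111≐R≤
    }

proposition4p5 : ∀ {c ℓ₁ ℓ₂} (H : HeytingAlgebra c ℓ₁ ℓ₂) → Canonical.IsHeytingFrame H
proposition4p5 H = CanonicalFrame.isHeytingFrame H
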